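{- Let $w\in S_\infty$, $k\leq l$, and let $\eta=\eta_1+2\eta_2$ be a multi-set with $|\eta_1|+2|\eta_2|=k+l$ such that $A_l^\eta(w)$ and $A_k^\eta(w)$ are both non-empty. Then $\beta_{\max}\subseteq\alpha_{\max}$ and $\beta_{\min}\cap\beta_{\max}=\eta_2$.
   Context: For $w\in S_\infty$ and $m\geq1$, $w^m$ is the increasing ordering of $w(1),\dots,w(m)$; for strictly increasing sequences of equal length, $\alpha\leq\gamma$ means entrywise $\leq$. $A_m(w)$ is the set of strictly increasing sequences $\alpha$ of $m$ positive integers with $\alpha\leq w^m$; sequences are identified with finite sets. A multi-set with multiplicities at most 2 is written $\eta=\eta_1+2\eta_2$ ($\eta_1,\eta_2$ disjoint sets of elements of multiplicity 1, 2); for sets $\alpha,\beta$, $\alpha+\beta$ is their multi-set union. $A_m^\eta(w):=\{\alpha\in A_m(w):\eta_2\subseteq\alpha\subseteq\eta_1\cup\eta_2\}$; when non-empty it has a unique element $\geq$ all its other elements. $\alpha_{\max}$ is this element for $A_l^\eta(w)$, $\beta_{\max}$ that for $A_k^\eta(w)$, and $\beta_{\min}$ is the unique set with $\alpha_{\max}+\beta_{\min}=\eta$. -}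

module Defs where

open import Data.Nat using (ℕ; zero; suc; _+_; _*_; _≤_; _<_; _≟_)
open import Data.Nat.Properties using (≤-decTotalOrder)
open import Data.List using (List; []; _∷_; map; length; filter)
open import Data.List.Relation.Unary.All using (All)
open import Data.List.Relation.Unary.Linked using (Linked)
open import Data.List.Relation.Binary.Pointwise using (Pointwise)
open import Data.List.Relation.Binary.Subset.Propositional using (_⊆_)
open import Data.List.Membership.Propositional using (_∈_; _∉_)
open import Data.List.Sort.MergeSort.Base ≤-decTotalOrder using (sort)
open import Data.Product using (Σ; _×_)
open import Relation.Binary.PropositionalEquality using (_≡_)

-- S_∞ : permutations of the positive integers {1,2,...} moving only
-- finitely many points.  We represent them as bijections of ℕ fixing 0
-- (0 is a dummy point), i.e. bijections of ℕ⁺ extended by 0 ↦ 0.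

record S∞ : Set where
  field
    fun        : ℕ → ℕ
    inv        : ℕ → ℕ
    inv-fun    : ∀ i → inv (fun i) ≡ i
    fun-inv    : ∀ i → fun (inv i) ≡ i
    fixes-zero : fun 0 ≡ 0
    finite-support : Σ ℕ λ N → ∀ i → N < i → fun i ≡ i
open S∞ public

-- Finite sets of positive integers are strictly increasing lists of
-- positive integers.

IsSet : List ℕ → Set
IsSet xs = Linked _<_ xs × All (1 ≤_) xs

range : ℕ → List ℕ
range zero    = []
range (suc m) = Data.List._++_ (range m) (suc m ∷ [])

_^^_ : S∞ → ℕ → List ℕ
w ^^ m = sort (map (fun w) (range m))

_≤ₛ_ : List ℕ → List ℕ → Set
α ≤ₛ γ = Pointwise _≤_ α γ

InA : S∞ → ℕ → List ℕ → Set
InA w m α = IsSet α × length α ≡ m × α ≤ₛ (w ^^ m)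

-- A multi-set with multiplicities at most 2:  η = η₁ + 2 η₂
record MultiSet₂ : Set where
  field
    η₁ η₂    : List ℕ
    η₁-set   : IsSet η₁
    η₂-set   : IsSet η₂
    disjoint : ∀ x → x ∈ η₁ → x ∉ η₂
open MultiSet₂ public

count : ℕ → List ℕ → ℕ
count x xs = length (filter (x ≟_) xs)

mult : MultiSet₂ → ℕ → ℕ
mult η x = count x (η₁ η) + 2 * count x (η₂ η)

size : MultiSet₂ → ℕ
size η = length (η₁ η) + 2 * length (η₂ η)

InAη : S∞ → ℕ → MultiSet₂ → List ℕ → Set
InAη w m η α =
  InA w m α × η₂ η ⊆ α × (∀ {x} → x ∈ α → x ∈ η₁ η Data.Sum.⊎ x ∈ η₂ η)
  where import Data.Sum

IsMaxAη : S∞ → ℕ → MultiSet₂ → List ℕ → Set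
IsMaxAη w m η α = InAη w m η α × (∀ γ → InAη w m η γ → γ ≤ₛ α)

SumIs : List ℕ → List ℕ → MultiSet₂ → Set
SumIs α β η = ∀ x → count x α + count x β ≡ mult η x

{-# OPTIONS --safe #-}
module Submission where

-- Record a set M by its rank function t ↦ #{a ∈ M : a ≤ t}; for sorted
-- sequences of equal length, M ≤ w^m entrywise iff rank (w^m) ≤ rank M pointwise.
-- Call t tight for M when these ranks agree.  If M is the maximum of A_m^η(w), no
-- x ∈ M ∖ η₂ can be traded for a larger y ∈ (η₁ ∪ η₂) ∖ M unless some t ∈ [x, y) is
-- tight, since otherwise the traded set stays in A_m^η(w) and exceeds M.
-- Suppose b ∈ βmax ∖ αmax.  Let t₁ < b be the last tight point of αmax and t₂ ≥ b
-- the first tight point of βmax.  Trading shows that αmax ⊆ βmax on (t₁, t₂], so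
-- there the multiset αmax + {b} + w^k is dominated by βmax + w^l (w^k ⊆ w^l, k ≤ l).
-- Hence rank (αmax + {b} + w^k) ≤ rank (βmax + w^l) propagates from t₁, where it
-- holds by tightness of αmax, to t₂, where tightness of βmax makes it fail.
-- Given βmax ⊆ αmax, the η₂ part is counting: x ∈ αmax ∩ βmin iff x has multiplicity 2 in η.

open import Defs
open import Data.Nat using (ℕ; zero; suc; _+_; _*_; _≤_; _<_; _≤′_; ≤′-refl; ≤′-step; _≟_; _≤?_; z≤n; s≤s; s≤s⁻¹)
open import Data.Nat.Properties
open import Data.Nat.ListAction using (sum)
open import Data.List using (List; []; _∷_; _++_; [_]; length; filter; map)
open import Data.List.Properties using (filter-++; filter-accept; filter-reject; filter-all; filter-none; length-filter; length-++; length-map; map-++)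
open import Data.List.Relation.Unary.All as All using (All; []; _∷_)
open import Data.List.Relation.Unary.All.Properties using (¬Any⇒All¬; ++⁻; ++⁺)
open import Data.List.Relation.Unary.Any using (here; there)
open import Data.List.Relation.Unary.Linked as Linked using (Linked; []; [-]; _∷_)
open import Data.List.Relation.Unary.Linked.Properties using (Linked⇒All)
open import Data.List.Relation.Binary.Pointwise using ([]; _∷_)
open import Data.List.Relation.Binary.Permutation.Propositional using (_↭_; ↭-refl; ↭-sym; prep; swap; module PermutationReasoning)
open import Data.List.Relation.Binary.Permutation.Propositional.Properties using (↭-length; filter-↭; ∈-resp-↭; All-resp-↭; shift)
open import Data.List.Sort.MergeSort.Base ≤-decTotalOrder using (sort)
open import Data.List.Sort.MergeSort.Properties ≤-decTotalOrder using (sort-↭; sort-↗)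
open import Data.List.Membership.Propositional using (_∈_; _∉_)
open import Data.List.Membership.Propositional.Properties using (∈-∃++)
open import Data.List.Membership.DecPropositional _≟_ using (_∈?_)
open import Data.List.Relation.Binary.Subset.Propositional using (_⊆_)
open import Data.Product using (∃-syntax; _×_; _,_; proj₁; proj₂)
open import Data.Empty using (⊥-elim)
open import Data.Sum using (_⊎_; inj₁; inj₂)
open import Function using (_∘_)
open import Function.Bundles using (_⇔_; mk⇔; module Equivalence)
open import Relation.Binary using (tri<; tri≈; tri>)
open import Relation.Binary.PropositionalEquality using (_≡_; _≢_; refl; sym; trans; cong; subst; subst₂; module ≡-Reasoning)
open import Relation.Nullary using (¬_; yes; no; contradiction)
open import Relation.Unary using (Decidable)

count-++ : ∀ x xs ys → count x (xs ++ ys) ≡ count x xs + count x ys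
count-++ x xs ys = trans (cong length (filter-++ (x ≟_) xs ys)) (length-++ (filter (x ≟_) xs))

count≤count-∷ : ∀ s x xs → count s xs ≤ count s (x ∷ xs)
count≤count-∷ s x xs = subst (count s xs ≤_) (sym (count-++ s [ x ] xs)) (m≤n+m _ _)

count-↭ : ∀ x {xs ys} → xs ↭ ys → count x xs ≡ count x ys
count-↭ x xs↭ys = ↭-length (filter-↭ (x ≟_) xs↭ys)

count-∷-≡ : ∀ x xs → count x (x ∷ xs) ≡ suc (count x xs)
count-∷-≡ x xs = cong length (filter-accept (x ≟_) refl)

count-∷-≢ : ∀ {x y} xs → x ≢ y → count x (y ∷ xs) ≡ count x xs
count-∷-≢ {x} xs x≢y = cong length (filter-reject (x ≟_) x≢y)

count-none : ∀ {x xs} → All (x ≢_) xs → count x xs ≡ 0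
count-none {x} xs≢x = cong length (filter-none (x ≟_) xs≢x)

∉⇒count≡0 : ∀ {x xs} → x ∉ xs → count x xs ≡ 0
∉⇒count≡0 {xs = xs} x∉xs = count-none (¬Any⇒All¬ xs x∉xs)

∈⇒1≤count : ∀ {x xs} → x ∈ xs → 1 ≤ count x xs
∈⇒1≤count {x} {.x ∷ xs} (here refl) = subst (1 ≤_) (sym (count-∷-≡ x xs)) (s≤s z≤n)
∈⇒1≤count {x} {y ∷ xs} (there x∈xs) = ≤-trans (∈⇒1≤count x∈xs) (count≤count-∷ x y xs)

1≤count⇒∈ : ∀ {x xs} → 1 ≤ count x xs → x ∈ xs
1≤count⇒∈ {x} {xs} 1≤count with x ∈? xs
... | yes x∈xs = x∈xs
... | no x∉xs = contradiction (subst (1 ≤_) (∉⇒count≡0 x∉xs) 1≤count) λ ()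

strictly-sorted-count≤1 : ∀ {x xs} → Linked _<_ xs → count x xs ≤ 1
strictly-sorted-count≤1 {xs = []} _ = z≤n
strictly-sorted-count≤1 {x} {y ∷ ys} y∷ys↗ with x ≟ y
... | no x≢y = subst (_≤ 1) (sym (count-∷-≢ ys x≢y)) (strictly-sorted-count≤1 (Linked.tail y∷ys↗))
... | yes refl = subst (_≤ 1) (sym (trans (count-∷-≡ x ys) (cong suc (count-none (All.map <⇒≢ (above-head y∷ys↗)))))) ≤-refl
  where
  above-head : ∀ {zs} → Linked _<_ (x ∷ zs) → All (x <_) zs
  above-head [-] = []
  above-head (x<z ∷ z∷zs↗) = Linked⇒All <-trans x<z z∷zs↗

set-count≤1 : ∀ {x xs} → IsSet xs → count x xs ≤ 1
set-count≤1 (xs↗ , _) = strictly-sorted-count≤1 xs↗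

set-∷-count≤1 : ∀ {y M} → IsSet M → y ∉ M → ∀ s → count s (y ∷ M) ≤ 1
set-∷-count≤1 {y} {M} M-set y∉M s with s ≟ y
... | yes refl = ≤-reflexive (trans (count-∷-≡ y M) (cong suc (∉⇒count≡0 y∉M)))
... | no s≢y = subst (_≤ 1) (sym (count-∷-≢ M s≢y)) (set-count≤1 M-set)

count≤1-mono : ∀ {x xs ys} → count x xs ≤ 1 → (x ∈ xs → x ∈ ys) → count x xs ≤ count x ys
count≤1-mono {x} {xs} count≤1 xs→ys with x ∈? xs
... | yes x∈xs = ≤-trans count≤1 (∈⇒1≤count (xs→ys x∈xs))
... | no x∉xs = subst (_≤ _) (sym (∉⇒count≡0 x∉xs)) z≤n

sorted-count≤1⇒strictly-sorted : ∀ {xs} → Linked _≤_ xs → (∀ s → count s xs ≤ 1) → Linked _<_ xs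
sorted-count≤1⇒strictly-sorted [] _ = []
sorted-count≤1⇒strictly-sorted [-] _ = [-]
sorted-count≤1⇒strictly-sorted {x ∷ y ∷ ys} (x≤y ∷ y∷ys↗) count≤1 =
  ≤∧≢⇒< x≤y x≢y ∷ sorted-count≤1⇒strictly-sorted y∷ys↗ (λ s → ≤-trans (count≤count-∷ s x (y ∷ ys)) (count≤1 s))
  where
  x≢y : x ≢ y
  x≢y refl = contradiction (subst (_≤ 1) (trans (count-∷-≡ x (x ∷ ys)) (cong suc (count-∷-≡ x ys))) (count≤1 x)) λ { (s≤s ()) }

set⇒sorted : ∀ {xs} → IsSet xs → Linked _≤_ xs
set⇒sorted (xs↗ , _) = Linked.map <⇒≤ xs↗

All-≤-sum : ∀ xs → All (_≤ sum xs) xs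
All-≤-sum [] = []
All-≤-sum (x ∷ xs) = m≤m+n x (sum xs) ∷ All.map (λ y≤Σ → ≤-trans y≤Σ (m≤n+m (sum xs) x)) (All-≤-sum xs)

rank : List ℕ → ℕ → ℕ
rank xs t = length (filter (_≤? t) xs)

rank-++ : ∀ xs ys t → rank (xs ++ ys) t ≡ rank xs t + rank ys t
rank-++ xs ys t = trans (cong length (filter-++ (_≤? t) xs ys)) (length-++ (filter (_≤? t) xs))

rank-↭ : ∀ {xs ys} t → xs ↭ ys → rank xs t ≡ rank ys t
rank-↭ t xs↭ys = ↭-length (filter-↭ (_≤? t) xs↭ys)

rank-∷-≤ : ∀ {x t} xs → x ≤ t → rank (x ∷ xs) t ≡ suc (rank xs t)
rank-∷-≤ {t = t} xs x≤t = cong length (filter-accept (_≤? t) x≤t)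

rank-∷-> : ∀ {x t} xs → t < x → rank (x ∷ xs) t ≡ rank xs t
rank-∷-> {t = t} xs t<x = cong length (filter-reject (_≤? t) (<⇒≱ t<x))

rank-all≤ : ∀ {xs t} → All (_≤ t) xs → rank xs t ≡ length xs
rank-all≤ {t = t} xs≤t = cong length (filter-all (_≤? t) xs≤t)

rank-all> : ∀ {xs t} → All (t <_) xs → rank xs t ≡ 0
rank-all> {t = t} t<xs = cong length (filter-none (_≤? t) (All.map <⇒≱ t<xs))

rank≤length : ∀ xs t → rank xs t ≤ length xs
rank≤length xs t = length-filter (_≤? t) xs

rank-suc : ∀ xs t → rank xs (suc t) ≡ rank xs t + count (suc t) xs
rank-suc [] t = refl
rank-suc (x ∷ xs) t with x ≤? t | suc t ≟ x
... | yes x≤t | _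
  rewrite rank-∷-≤ xs x≤t | rank-∷-≤ xs (m≤n⇒m≤1+n x≤t) | count-∷-≢ xs (<⇒≢ (s≤s x≤t) ∘ sym) | rank-suc xs t = refl
... | no x≰t | yes refl
  rewrite rank-∷-> xs (≰⇒> x≰t) | rank-∷-≤ xs (≤-refl {suc t}) | count-∷-≡ (suc t) xs | rank-suc xs t = sym (+-suc _ _)
... | no x≰t | no t+1≢x
  rewrite rank-∷-> xs (≰⇒> x≰t) | rank-∷-> xs (≤∧≢⇒< (≰⇒> x≰t) t+1≢x) | count-∷-≢ xs t+1≢x = rank-suc xs t

rank-below-head : ∀ {y ys t} → Linked _≤_ (y ∷ ys) → t < y → rank (y ∷ ys) t ≡ 0
rank-below-head y∷ys↗ t<y = rank-all> (All.map (<-≤-trans t<y) (Linked⇒All ≤-trans ≤-refl y∷ys↗))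

rank-≤-propagates : ∀ {P Q t u} → t ≤ u → (∀ {s} → t < s → s ≤ u → count s P ≤ count s Q) →
                    rank P t ≤ rank Q t → rank P u ≤ rank Q u
rank-≤-propagates {P} {Q} {t} t≤u P≤Q = go (≤⇒≤′ t≤u) P≤Q
  where
  go : ∀ {u} → t ≤′ u → (∀ {s} → t < s → s ≤ u → count s P ≤ count s Q) → rank P t ≤ rank Q t → rank P u ≤ rank Q u
  go ≤′-refl _ at-t = at-t
  go (≤′-step {u} t≤′u) P≤Q at-t = begin
    rank P (suc u)           ≡⟨ rank-suc P u ⟩
    rank P u + count (suc u) P ≤⟨ +-mono-≤ (go t≤′u (λ t<s s≤u → P≤Q t<s (m≤n⇒m≤1+n s≤u)) at-t) (P≤Q (s≤s (≤′⇒≤ t≤′u)) ≤-refl) ⟩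
    rank Q u + count (suc u) Q ≡⟨ rank-suc Q u ⟨
    rank Q (suc u)           ∎
    where open ≤-Reasoning

pointwise⇒rank≥ : ∀ {xs ys} → Linked _≤_ ys → xs ≤ₛ ys → ∀ t → rank ys t ≤ rank xs t
pointwise⇒rank≥ _ [] t = z≤n
pointwise⇒rank≥ {x ∷ xs} {y ∷ ys} ys↗ (x≤y ∷ xs≤ys) t with y ≤? t
... | yes y≤t = begin
  rank (y ∷ ys) t ≡⟨ rank-∷-≤ ys y≤t ⟩
  suc (rank ys t) ≤⟨ s≤s (pointwise⇒rank≥ (Linked.tail ys↗) xs≤ys t) ⟩
  suc (rank xs t) ≡⟨ rank-∷-≤ xs (≤-trans x≤y y≤t) ⟨
  rank (x ∷ xs) t ∎
  where open ≤-Reasoning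
... | no y≰t = subst (_≤ _) (sym (rank-below-head ys↗ (≰⇒> y≰t))) z≤n

rank≥⇒pointwise : ∀ {xs ys} → Linked _≤_ xs → Linked _≤_ ys → length xs ≡ length ys →
                  (∀ t → rank ys t ≤ rank xs t) → xs ≤ₛ ys
rank≥⇒pointwise {[]} {[]} _ _ _ _ = []
rank≥⇒pointwise {x ∷ xs} {y ∷ ys} xs↗ ys↗ |xs|≡|ys| ranks =
  x≤y ∷ rank≥⇒pointwise (Linked.tail xs↗) (Linked.tail ys↗) (suc-injective |xs|≡|ys|) tail-ranks
  where
  x≤y : x ≤ y
  x≤y = ≮⇒≥ λ y<x → n≮0 (subst₂ _≤_ (rank-∷-≤ ys (≤-refl {y})) (rank-below-head xs↗ y<x) (ranks y))
  tail-ranks : ∀ t → rank ys t ≤ rank xs t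
  tail-ranks t with y ≤? t
  ... | yes y≤t = s≤s⁻¹ (subst₂ _≤_ (rank-∷-≤ ys y≤t) (rank-∷-≤ xs (≤-trans x≤y y≤t)) (ranks t))
  ... | no y≰t = subst (_≤ _) (sym (trans (sym (rank-∷-> ys (≰⇒> y≰t))) (rank-below-head ys↗ (≰⇒> y≰t)))) z≤n

length-range : ∀ m → length (range m) ≡ m
length-range zero = refl
length-range (suc m) = trans (length-++ (range m)) (trans (cong (_+ 1) (length-range m)) (+-comm m 1))

^^-sorted : ∀ w m → Linked _≤_ (w ^^ m)
^^-sorted w m = sort-↗ (map (fun w) (range m))

^^-length : ∀ w m → length (w ^^ m) ≡ m
^^-length w m = begin
  length (w ^^ m)                  ≡⟨ ↭-length (sort-↭ (map (fun w) (range m))) ⟩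
  length (map (fun w) (range m))   ≡⟨ length-map (fun w) (range m) ⟩
  length (range m)                 ≡⟨ length-range m ⟩
  m                                ∎
  where open ≡-Reasoning

count-^^-mono : ∀ w s {k l} → k ≤ l → count s (w ^^ k) ≤ count s (w ^^ l)
count-^^-mono w s {k} {l} k≤l =
  subst₂ _≤_ (sym (count-↭ s (sort-↭ (image k)))) (sym (count-↭ s (sort-↭ (image l)))) (go (≤⇒≤′ k≤l))
  where
  image : ℕ → List ℕ
  image n = map (fun w) (range n)
  go : ∀ {n} → k ≤′ n → count s (image k) ≤ count s (image n)
  go ≤′-refl = ≤-refl
  go (≤′-step {n} k≤′n) = begin
    count s (image k)                                   ≤⟨ go k≤′n ⟩
    count s (image n)                                   ≤⟨ m≤m+n _ _ ⟩
    count s (image n) + count s [ fun w (suc n) ]       ≡⟨ count-++ s (image n) [ fun w (suc n) ] ⟨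
    count s (image n ++ [ fun w (suc n) ])              ≡⟨ cong (count s) (map-++ (fun w) (range n) [ suc n ]) ⟨
    count s (image (suc n))                             ∎
    where open ≤-Reasoning

∈-exchange : ∀ {x y z : ℕ} {xs ys} → x ∷ xs ↭ y ∷ ys → z ∈ xs → z ∈ ys ⊎ z ≡ y
∈-exchange x∷xs↭y∷ys z∈xs with ∈-resp-↭ x∷xs↭y∷ys (there z∈xs)
... | here z≡y = inj₂ z≡y
... | there z∈ys = inj₁ z∈ys

set-exchange : ∀ {M x y} → IsSet M → x ∈ M → y ∉ M → 1 ≤ y → ∃[ γ ] IsSet γ × x ∷ γ ↭ y ∷ M
set-exchange {M} {x} {y} M-set@(_ , 1≤M) x∈M y∉M 1≤y with ∈-∃++ x∈M
... | ys , zs , refl = sort l , (strictly-sorted , All-resp-↭ (↭-sym (sort-↭ l)) (1≤y ∷ ++⁺ 1≤ys 1≤zs)) , x∷γ↭y∷M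
  where
  l = y ∷ ys ++ zs
  1≤ys = proj₁ (++⁻ ys 1≤M)
  1≤zs = All.tail (proj₂ (++⁻ ys 1≤M))
  x∷γ↭y∷M : x ∷ sort l ↭ y ∷ ys ++ x ∷ zs
  x∷γ↭y∷M = begin
    x ∷ sort l        ↭⟨ prep x (sort-↭ l) ⟩
    x ∷ y ∷ ys ++ zs  ↭⟨ swap x y ↭-refl ⟩
    y ∷ x ∷ ys ++ zs  ↭⟨ prep y (shift x ys zs) ⟨
    y ∷ ys ++ x ∷ zs  ∎
    where open PermutationReasoning
  strictly-sorted : Linked _<_ (sort l)
  strictly-sorted = sorted-count≤1⇒strictly-sorted (sort-↗ l) λ s → begin
    count s (sort l)               ≤⟨ count≤count-∷ s x (sort l) ⟩
    count s (x ∷ sort l)           ≡⟨ count-↭ s x∷γ↭y∷M ⟩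
    count s (y ∷ ys ++ x ∷ zs)     ≤⟨ set-∷-count≤1 M-set y∉M s ⟩
    1                              ∎
    where open ≤-Reasoning

module _ {P : ℕ → Set} (P? : Decidable P) where

  last-below : P 0 → ∀ n → ∃[ t ] t ≤ n × P t × (∀ {s} → t < s → s ≤ n → ¬ P s)
  last-below P0 zero = 0 , z≤n , P0 , λ 0<s s≤0 → contradiction s≤0 (<⇒≱ 0<s)
  last-below P0 (suc n) with P? (suc n)
  ... | yes Pn+1 = suc n , ≤-refl , Pn+1 , λ n+1<s s≤n+1 → contradiction s≤n+1 (<⇒≱ n+1<s)
  ... | no ¬Pn+1 with last-below P0 n
  ... | t , t≤n , Pt , ¬P-after = t , m≤n⇒m≤1+n t≤n , Pt , after
    where
    after : ∀ {s} → t < s → s ≤ suc n → ¬ P s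
    after t<s s≤n+1 with m≤n⇒m<n∨m≡n s≤n+1
    ... | inj₁ s<n+1 = ¬P-after t<s (s≤s⁻¹ s<n+1)
    ... | inj₂ refl = ¬Pn+1

  first-from : ∀ b n → P (b + n) → ∃[ t ] b ≤ t × P t × (∀ {s} → b ≤ s → s < t → ¬ P s)
  first-from b n Pb+n with P? b
  ... | yes Pb = b , ≤-refl , Pb , λ b≤s s<b → contradiction b≤s (<⇒≱ s<b)
  first-from b zero Pb+0 | no ¬Pb = contradiction (subst P (+-identityʳ b) Pb+0) ¬Pb
  first-from b (suc n) Pb+n+1 | no ¬Pb with first-from (suc b) n (subst P (+-suc b n) Pb+n+1)
  ... | t , b<t , Pt , ¬P-before = t , <⇒≤ b<t , Pt , before
    where
    before : ∀ {s} → b ≤ s → s < t → ¬ P s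
    before b≤s s<t with m≤n⇒m<n∨m≡n b≤s
    ... | inj₁ b<s = ¬P-before b<s s<t
    ... | inj₂ refl = ¬Pb

-- For M ≤ₛ w ^^ m we always have rank (w ^^ m) ≤ rank M, so tightness means equality.
Tight : S∞ → ℕ → List ℕ → ℕ → Set
Tight w m M t = rank M t ≤ rank (w ^^ m) t

Tight? : ∀ w m M → Decidable (Tight w m M)
Tight? w m M t = rank M t ≤? rank (w ^^ m) t

last-tight-below : ∀ {w m M} → IsSet M → ∀ n →
  ∃[ t ] t ≤ n × Tight w m M t × (∀ {s} → t < s → s ≤ n → ¬ Tight w m M s)
last-tight-below {w} {m} {M} (_ , 1≤M) = last-below (Tight? w m M) (subst (_≤ _) (sym (rank-all> 1≤M)) z≤n)

first-tight-from : ∀ {w m M} → length M ≡ m → ∀ b →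
  ∃[ t ] b ≤ t × Tight w m M t × (∀ {s} → b ≤ s → s < t → ¬ Tight w m M s)
first-tight-from {w} {m} {M} |M|≡m b = first-from (Tight? w m M) b (sum (w ^^ m)) tight
  where
  open ≤-Reasoning
  N = b + sum (w ^^ m)
  tight : Tight w m M N
  tight = begin
    rank M N         ≤⟨ rank≤length M N ⟩
    length M         ≡⟨ trans |M|≡m (sym (^^-length w m)) ⟩
    length (w ^^ m)  ≡⟨ rank-all≤ (All.map (λ x≤Σ → ≤-trans x≤Σ (m≤n+m _ b)) (All-≤-sum (w ^^ m))) ⟨
    rank (w ^^ m) N  ∎

no-exchange-across-slack : ∀ {w m η M x y} → IsMaxAη w m η M →
  x ∈ M → x ∉ η₂ η → y ∉ M → y ∈ η₁ η ⊎ y ∈ η₂ η → x < y →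
  ¬ (∀ {t} → x ≤ t → t < y → ¬ Tight w m M t)
no-exchange-across-slack {w} {m} {η} {M} {x} {y} (((M-set , |M|≡m , M≤W) , η₂⊆M , M⊆η) , M-max) x∈M x∉η₂ y∉M y∈η x<y slack
  with set-exchange M-set x∈M y∉M (≤-trans (s≤s z≤n) x<y)
... | γ , γ-set , x∷γ↭y∷M = 1+n≰n (subst (_≤ rank γ x) (sym (γ<M ≤-refl x<y)) (pointwise⇒rank≥ (set⇒sorted M-set) γ≤M x))
  where
  W = w ^^ m
  ranks : ∀ t → rank (x ∷ γ) t ≡ rank (y ∷ M) t
  ranks t = rank-↭ t x∷γ↭y∷M
  γ=M-above : ∀ {t} → y ≤ t → rank γ t ≡ rank M t
  γ=M-above y≤t = suc-injective (trans (sym (rank-∷-≤ γ (≤-trans (<⇒≤ x<y) y≤t))) (trans (ranks _) (rank-∷-≤ M y≤t)))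
  γ<M : ∀ {t} → x ≤ t → t < y → suc (rank γ t) ≡ rank M t
  γ<M x≤t t<y = trans (sym (rank-∷-≤ γ x≤t)) (trans (ranks _) (rank-∷-> M t<y))
  γ=M-below : ∀ {t} → t < x → rank γ t ≡ rank M t
  γ=M-below t<x = trans (sym (rank-∷-> γ t<x)) (trans (ranks _) (rank-∷-> M (<-trans t<x x<y)))
  W≤M : ∀ t → rank W t ≤ rank M t
  W≤M = pointwise⇒rank≥ (^^-sorted w m) M≤W
  W≤γ : ∀ t → rank W t ≤ rank γ t
  W≤γ t with y ≤? t | x ≤? t
  ... | yes y≤t | _ = subst (rank W t ≤_) (sym (γ=M-above y≤t)) (W≤M t)
  ... | no y≰t | yes x≤t = s≤s⁻¹ (subst (rank W t <_) (sym (γ<M x≤t (≰⇒> y≰t))) (≰⇒> (slack x≤t (≰⇒> y≰t))))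
  ... | no _ | no x≰t = subst (rank W t ≤_) (sym (γ=M-below (≰⇒> x≰t))) (W≤M t)
  |γ|≡m : length γ ≡ m
  |γ|≡m = trans (suc-injective (↭-length x∷γ↭y∷M)) |M|≡m
  η₂⊆γ : η₂ η ⊆ γ
  η₂⊆γ z∈η₂ with ∈-exchange (↭-sym x∷γ↭y∷M) (η₂⊆M z∈η₂)
  ... | inj₁ z∈γ = z∈γ
  ... | inj₂ refl = contradiction z∈η₂ x∉η₂
  γ⊆η : ∀ {z} → z ∈ γ → z ∈ η₁ η ⊎ z ∈ η₂ η
  γ⊆η z∈γ with ∈-exchange x∷γ↭y∷M z∈γ
  ... | inj₁ z∈M = M⊆η z∈M
  ... | inj₂ refl = y∈η
  γ≤M : γ ≤ₛ M
  γ≤M = M-max γ ((γ-set , |γ|≡m , rank≥⇒pointwise (set⇒sorted γ-set) (^^-sorted w m) (trans |γ|≡m (sym (^^-length w m))) W≤γ) , η₂⊆γ , γ⊆η)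

max-⊆-between : ∀ {w k l η A B b t₁ t₂} → IsMaxAη w l η A → IsMaxAη w k η B → b ∈ B → b ∉ A →
  (∀ {t} → t₁ < t → t < b → ¬ Tight w l A t) → (∀ {t} → b ≤ t → t < t₂ → ¬ Tight w k B t) →
  ∀ {s} → t₁ < s → s ≤ t₂ → s ∈ A → s ∈ B
max-⊆-between {w} {k} {l} {η} {A} {B} {b} A-max@((_ , η₂⊆A , A⊆η) , _) B-max@((_ , η₂⊆B , B⊆η) , _)
  b∈B b∉A A-slack B-slack {s} t₁<s s≤t₂ s∈A with s ∈? B | <-cmp s b
... | yes s∈B | _ = s∈B
... | no s∉B | tri< s<b _ _ = ⊥-elim (no-exchange-across-slack {w} {l} {η} {A} A-max s∈A (s∉B ∘ η₂⊆B) b∉A (B⊆η b∈B) s<b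
  λ s≤t t<b → A-slack (<-≤-trans t₁<s s≤t) t<b)
... | no _ | tri≈ _ refl _ = contradiction s∈A b∉A
... | no s∉B | tri> _ _ b<s = ⊥-elim (no-exchange-across-slack {w} {k} {η} {B} B-max b∈B (b∉A ∘ η₂⊆A) s∉B (A⊆η s∈A) b<s
  λ b≤t t<s → B-slack b≤t (<-≤-trans t<s s≤t₂))

max-⊆-suc : ∀ {w k l η A B p} → k ≤ l → IsMaxAη w l η A → IsMaxAη w k η B → suc p ∈ B → suc p ∈ A
max-⊆-suc {w} {k} {l} {η} {A} {B} {p} k≤l
  A-max@(((A-set , _ , A≤Wl) , _) , _) B-max@(((_ , |B|≡k , B≤Wk) , _) , _) b∈B with suc p ∈? A
... | yes b∈A = b∈A
... | no b∉A with last-tight-below {w} {l} A-set p | first-tight-from {w} {k} {B} |B|≡k (suc p)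
... | t₁ , t₁≤p , A-tight-t₁ , A-slack | t₂ , b≤t₂ , B-tight-t₂ , B-slack =
  contradiction (rank-≤-propagates {Wk ++ b ∷ A} {B ++ Wl} (≤-trans t₁≤p (≤-trans (n≤1+n p) b≤t₂)) dominated at-t₁) (<⇒≱ at-t₂)
  where
  b = suc p
  Wk = w ^^ k
  Wl = w ^^ l
  dominated : ∀ {s} → t₁ < s → s ≤ t₂ → count s (Wk ++ b ∷ A) ≤ count s (B ++ Wl)
  dominated {s} t₁<s s≤t₂ = begin
    count s (Wk ++ b ∷ A)         ≡⟨ count-++ s Wk (b ∷ A) ⟩
    count s Wk + count s (b ∷ A)  ≡⟨ +-comm (count s Wk) _ ⟩
    count s (b ∷ A) + count s Wk  ≤⟨ +-mono-≤ (count≤1-mono (set-∷-count≤1 A-set b∉A s) b∷A⊆B) (count-^^-mono w s k≤l) ⟩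
    count s B + count s Wl        ≡⟨ count-++ s B Wl ⟨
    count s (B ++ Wl)             ∎
    where
    open ≤-Reasoning
    b∷A⊆B : s ∈ b ∷ A → s ∈ B
    b∷A⊆B (here refl) = b∈B
    b∷A⊆B (there s∈A) = max-⊆-between {w} {k} {l} {η} A-max B-max b∈B b∉A
      (λ t₁<t t<b → A-slack t₁<t (s≤s⁻¹ t<b)) B-slack t₁<s s≤t₂ s∈A
  at-t₁ : rank (Wk ++ b ∷ A) t₁ ≤ rank (B ++ Wl) t₁
  at-t₁ = begin
    rank (Wk ++ b ∷ A) t₁         ≡⟨ rank-++ Wk (b ∷ A) t₁ ⟩
    rank Wk t₁ + rank (b ∷ A) t₁  ≡⟨ cong (rank Wk t₁ +_) (rank-∷-> A (s≤s t₁≤p)) ⟩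
    rank Wk t₁ + rank A t₁        ≤⟨ +-mono-≤ (pointwise⇒rank≥ (^^-sorted w k) B≤Wk t₁) A-tight-t₁ ⟩
    rank B t₁ + rank Wl t₁        ≡⟨ rank-++ B Wl t₁ ⟨
    rank (B ++ Wl) t₁             ∎
    where open ≤-Reasoning
  at-t₂ : rank (B ++ Wl) t₂ < rank (Wk ++ b ∷ A) t₂
  at-t₂ = begin-strict
    rank (B ++ Wl) t₂             ≡⟨ rank-++ B Wl t₂ ⟩
    rank B t₂ + rank Wl t₂        <⟨ +-mono-≤-< B-tight-t₂ (s≤s (pointwise⇒rank≥ (^^-sorted w l) A≤Wl t₂)) ⟩
    rank Wk t₂ + suc (rank A t₂)  ≡⟨ cong (rank Wk t₂ +_) (rank-∷-≤ A b≤t₂) ⟨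
    rank Wk t₂ + rank (b ∷ A) t₂  ≡⟨ rank-++ Wk (b ∷ A) t₂ ⟨
    rank (Wk ++ b ∷ A) t₂         ∎
    where open ≤-Reasoning

max-⊆ : ∀ {w k l η A B} → k ≤ l → IsMaxAη w l η A → IsMaxAη w k η B → B ⊆ A
max-⊆ _ _ ((((_ , 1≤B) , _) , _) , _) {zero} 0∈B = contradiction (All.lookup 1≤B 0∈B) λ ()
max-⊆ {w} {k} {l} {η} k≤l A-max B-max {suc p} = max-⊆-suc {w} {k} {l} {η} k≤l A-max B-max

∈η₂⇔2≤mult : ∀ η {x} → x ∈ η₂ η ⇔ 2 ≤ mult η x
∈η₂⇔2≤mult η {x} = mk⇔ (λ x∈η₂ → ≤-trans (*-monoʳ-≤ 2 (∈⇒1≤count x∈η₂)) (m≤n+m _ (count x (η₁ η)))) from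
  where
  from : 2 ≤ mult η x → x ∈ η₂ η
  from 2≤mult with x ∈? η₂ η
  ... | yes x∈η₂ = x∈η₂
  ... | no x∉η₂ = contradiction (set-count≤1 (η₁-set η))
    (<⇒≱ (subst (2 ≤_) (trans (cong (λ c → count x (η₁ η) + 2 * c) (∉⇒count≡0 x∉η₂)) (+-identityʳ _)) 2≤mult))

∈×∈⇔2≤count+count : ∀ {x α β} → IsSet α → IsSet β → (x ∈ α × x ∈ β) ⇔ 2 ≤ count x α + count x β
∈×∈⇔2≤count+count {x} {α} {β} α-set β-set = mk⇔
  (λ (x∈α , x∈β) → +-mono-≤ (∈⇒1≤count x∈α) (∈⇒1≤count x∈β))
  (λ 2≤sum → 1≤count⇒∈ (+-cancelʳ-≤ 1 1 _ (≤-trans 2≤sum (+-monoʳ-≤ (count x α) (set-count≤1 β-set))))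
           , 1≤count⇒∈ (+-cancelˡ-≤ 1 1 _ (≤-trans 2≤sum (+-monoˡ-≤ (count x β) (set-count≤1 α-set)))))

η₂-as-intersection : ∀ {η α β γ} → IsSet α → IsSet β → SumIs α β η → γ ⊆ α → η₂ η ⊆ γ →
  ∀ x → (x ∈ β × x ∈ γ) ⇔ x ∈ η₂ η
η₂-as-intersection {η} {α} {β} α-set β-set α+β≡η γ⊆α η₂⊆γ x = mk⇔
  (λ (x∈β , x∈γ) → from (∈η₂⇔2≤mult η) (subst (2 ≤_) (α+β≡η x) (to in-both (γ⊆α x∈γ , x∈β))))
  (λ x∈η₂ → proj₂ (from in-both (subst (2 ≤_) (sym (α+β≡η x)) (to (∈η₂⇔2≤mult η) x∈η₂))) , η₂⊆γ x∈η₂)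
  where
  open Equivalence
  in-both : (x ∈ α × x ∈ β) ⇔ 2 ≤ count x α + count x β
  in-both = ∈×∈⇔2≤count+count α-set β-set

proposition2p10 : (w : S∞) (k l : ℕ) → 1 ≤ k → k ≤ l → (η : MultiSet₂) →
    size η ≡ k + l →
    (αmax βmax βmin : List ℕ) →
    IsMaxAη w l η αmax → IsMaxAη w k η βmax →
    IsSet βmin → SumIs αmax βmin η →
    βmax ⊆ αmax × (∀ x → (x ∈ βmin × x ∈ βmax) ⇔ x ∈ η₂ η)
proposition2p10 w k l _ k≤l η _ αmax βmax βmin
  αmax-max@(((αmax-set , _) , _) , _) βmax-max@((_ , η₂⊆βmax , _) , _) βmin-set αmax+βmin≡η =
  βmax⊆αmax , η₂-as-intersection {η} αmax-set βmin-set αmax+βmin≡η βmax⊆αmax η₂⊆βmax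
  where
  βmax⊆αmax : βmax ⊆ αmax
  βmax⊆αmax = max-⊆ {w} {k} {l} {η} k≤l αmax-max βmax-max
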